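{- (1) $Q_{n,132}^{(0,0,1,0)}(0)=1$ for $n\ge1$; (2) $Q_{n,132}^{(0,0,1,0)}(x)|_{x^{n-1}}=1$ for $n\ge2$; (3) $Q_{n,132}^{(0,0,1,0)}(x)|_x=\binom{n}{2}$ for $n\ge2$; (4) $Q_{n,132}^{(0,0,1,0)}(x)|_{x^{n-2}}=\binom{n}{2}$ for $n\ge3$.
   Context: For $\sigma=\sigma_1\cdots\sigma_n\in S_n$, $\mathrm{mmp}^{(0,0,1,0)}(\sigma)$ is the number of positions $i$ such that some $j<i$ has $\sigma_j<\sigma_i$. $S_n(132)$ is the set of 132-avoiding permutations of $[n]$. $Q_{n,132}^{(0,0,1,0)}(x)=\sum_{\sigma\in S_n(132)}x^{\mathrm{mmp}^{(0,0,1,0)}(\sigma)}$. $P(x)|_{x^r}$ is the coefficient of $x^r$. -}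

module Defs where

open import Data.Nat using (ℕ; zero; suc; _<?_)
import Data.Nat
import Data.List
open import Data.List using (List; []; _∷_; length; filter; concatMap; upTo; map; _++_)
open import Data.Fin using (Fin)
import Data.Fin
open import Data.Product using (Σ; ∃; ∃-syntax; _×_; _,_)
open import Relation.Nullary using (¬_; Dec)
open import Data.Fin.Properties using (any?; all?)
open import Relation.Nullary.Decidable using (_×-dec_; ¬?)

-- A permutation of [n] is represented in one-line notation σ₁⋯σₙ as a
-- vector σ : Fin n → ℕ (values are 1..n).

insertions : ℕ → List ℕ → List (List ℕ)
insertions x [] = (x ∷ []) ∷ []
insertions x (y ∷ ys) = (x ∷ y ∷ ys) ∷ map (y ∷_) (insertions x ys)

perms : ℕ → List (List ℕ)
perms zero = [] ∷ []
perms (suc n) = concatMap (insertions (suc n)) (perms n)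

at : (l : List ℕ) → Fin (length l) → ℕ
at (x ∷ xs) Fin.zero = x
at (x ∷ xs) (Fin.suc i) = at xs i

Contains132 : List ℕ → Set
Contains132 σ = ∃[ i ] ∃[ j ] ∃[ k ]
  (i Data.Fin.< j × j Data.Fin.< k × at σ i Data.Nat.< at σ k × at σ k Data.Nat.< at σ j)

Avoids132 : List ℕ → Set
Avoids132 σ = ¬ Contains132 σ

avoids132? : (σ : List ℕ) → Dec (Avoids132 σ)
avoids132? σ = ¬? (any? λ i → any? λ j → any? λ k →
  (i Data.Fin.<? j) ×-dec ((j Data.Fin.<? k) ×-dec
  ((at σ i <? at σ k) ×-dec (at σ k <? at σ j))))

MmpPos : (σ : List ℕ) → Fin (length σ) → Set
MmpPos σ i = ∃[ j ] (j Data.Fin.< i × at σ j Data.Nat.< at σ i)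

mmpPos? : (σ : List ℕ) → (i : Fin (length σ)) → Dec (MmpPos σ i)
mmpPos? σ i = any? λ j → (j Data.Fin.<? i) ×-dec (at σ j <? at σ i)

mmp0010 : List ℕ → ℕ
mmp0010 σ = length (filter (mmpPos? σ) (Data.List.allFin (length σ)))

S132 : ℕ → List (List ℕ)
S132 n = filter avoids132? (perms n)

coeffQ : ℕ → ℕ → ℕ
coeffQ n r = length (filter (λ σ → mmp0010 σ Data.Nat.≟ r) (S132 n))

module Submission where

-- The proof uses a generating tree.  A list read after a prefix with minimum B
-- is described by three left-to-right scans: avoidsAfter (no 132 is created),
-- exceedAfter (entries above the running minimum) and sitesAfter (gaps where a
-- new maximum can be inserted without creating a 132).  Then it shows
-- that inserting n+1 into the avoiders of [n] yields the avoiders of [n+1],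
-- an avoider labelled (k , c) having children labelled (k+1 , c) and
-- (k , c+1), …, (1 , c+1); non-avoiders have no avoiding insertions.  So the
-- coefficient of x^r counts the labels (k , r) on level n of this label tree
-- (coeffQ-count).  The four statements are then proved by induction on the
-- level, using the invariant k + c ≤ n, where c = 0 forces k = n.

open import Data.Bool using (Bool; true; false; _∧_; _∨_; not; T; if_then_else_)
open import Data.Bool.Properties using (∧-zeroʳ; ∧-identityʳ; ∨-zeroʳ; ∨-identityʳ; ∨-assoc; not-involutive; T-≡; T-∨)
open import Data.Empty using (⊥-elim)
open import Data.Fin using (Fin; zero; suc)
import Data.Fin as Fin
open import Data.List using (List; []; _∷_; _++_; map; concatMap; filter; filterᵇ; tabulate; downFrom; length)
open import Data.List.Properties using (map-++; map-∘; map-cong; map-cong-local; filter-++; filter-≐; length-downFrom)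
open import Data.List.Relation.Unary.All using (All; []; _∷_; universal)
import Data.List.Relation.Unary.All as All
import Data.List.Relation.Unary.All.Properties as All
open import Data.Nat using (ℕ; zero; suc; _+_; _*_; _∸_; _≤_; _<_; _⊓_; _≤ᵇ_; _<ᵇ_; _≡ᵇ_; _≟_; z≤n; s≤s)
open import Data.Nat.Properties hiding (_≟_)
open import Algebra.Properties.CommutativeSemigroup +-commutativeSemigroup using (interchange)
open import Data.Nat.Combinatorics using (_C_; nC1≡n; nCk+nC[k+1]≡[n+1]C[k+1])
open import Data.Product using (_×_; _,_; proj₁; proj₂; ∃-syntax)
open import Data.Sum using (_⊎_; inj₁; inj₂)
open import Function using (_∘_)
open import Function.Bundles using (_⇔_; mk⇔; Equivalence)
open import Relation.Nullary using (Dec; yes; no; does; ¬_)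
open import Relation.Nullary.Decidable using (T?)
open import Relation.Unary using (_≐_)
open import Relation.Binary.PropositionalEquality
open import Defs

⟦_⟧ : Bool → ℕ
⟦ true ⟧ = 1
⟦ false ⟧ = 0

-- Kronecker delta; definitionally ⟦ does (m ≟ n) ⟧.
δ : ℕ → ℕ → ℕ
δ m n = ⟦ m ≡ᵇ n ⟧

δ-diag : ∀ n → δ n n ≡ 1
δ-diag zero = refl
δ-diag (suc n) = δ-diag n

δ-suc : ∀ n → δ n (suc n) ≡ 0
δ-suc zero = refl
δ-suc (suc n) = δ-suc n

δ-≢ : ∀ {m n} → m ≢ n → δ m n ≡ 0
δ-≢ {m} {n} m≢n with m ≡ᵇ n in eq
... | false = refl
... | true = ⊥-elim (m≢n (≡ᵇ⇒≡ m n (subst T (sym eq) _)))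

∧-not-true : ∀ {a s} → a ∧ not s ≡ true → a ≡ true × s ≡ false
∧-not-true {true} {false} _ = refl , refl
∧-not-true {true} {true} ()
∧-not-true {false} ()

∧-not-false : ∀ {a s} → a ∧ not s ≡ false → a ≡ false ⊎ s ≡ true
∧-not-false {false} _ = inj₁ refl
∧-not-false {true} {true} _ = inj₂ refl
∧-not-false {true} {false} ()

<ᵇ-true : ∀ {m n} → m < n → (m <ᵇ n) ≡ true
<ᵇ-true m<n = Equivalence.to T-≡ (<⇒<ᵇ m<n)

<ᵇ-false : ∀ {m n} → n ≤ m → (m <ᵇ n) ≡ false
<ᵇ-false {m} {n} n≤m with m <ᵇ n in eq
... | false = refl
... | true = ⊥-elim (<⇒≱ (<ᵇ⇒< m n (subst T (sym eq) _)) n≤m)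

≤ᵇ-true : ∀ {m n} → m ≤ n → (m ≤ᵇ n) ≡ true
≤ᵇ-true m≤n = Equivalence.to T-≡ (≤⇒≤ᵇ m≤n)

≤ᵇ-false : ∀ {m n} → n < m → (m ≤ᵇ n) ≡ false
≤ᵇ-false (s≤s n≤m) = <ᵇ-false n≤m

<ᵇ-not-≤ᵇ : ∀ B z → (B <ᵇ z) ≡ not (z ≤ᵇ B)
<ᵇ-not-≤ᵇ B z with z ≤ᵇ B in e
... | true = <ᵇ-false {B} {z} (≤ᵇ⇒≤ z B (subst T (sym e) _))
... | false = <ᵇ-true {B} {z} (≰⇒> λ z≤B → subst T e (≤⇒≤ᵇ z≤B))

private
  variable
    A A′ : Set

total : (A → ℕ) → List A → ℕ
total w [] = 0
total w (x ∷ xs) = w x + total w xs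

total-++ : (w : A → ℕ) (xs ys : List A) → total w (xs ++ ys) ≡ total w xs + total w ys
total-++ w [] ys = refl
total-++ w (x ∷ xs) ys = trans (cong (w x +_) (total-++ w xs ys)) (sym (+-assoc (w x) _ _))

total-cong : {v w : A → ℕ} {xs : List A} → All (λ x → v x ≡ w x) xs → total v xs ≡ total w xs
total-cong [] = refl
total-cong (e ∷ es) = cong₂ _+_ e (total-cong es)

total-+ : (v w : A → ℕ) (xs : List A) → total (λ x → v x + w x) xs ≡ total v xs + total w xs
total-+ v w [] = refl
total-+ v w (x ∷ xs) =
  trans (cong (v x + w x +_) (total-+ v w xs)) (interchange (v x) (w x) (total v xs) (total w xs))

total-scale : (a : ℕ) (w : A → ℕ) (xs : List A) → total (λ x → a * w x) xs ≡ a * total w xs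
total-scale a w [] = sym (*-zeroʳ a)
total-scale a w (x ∷ xs) = trans (cong (a * w x +_) (total-scale a w xs)) (sym (*-distribˡ-+ a (w x) _))

total-const : (a : ℕ) (xs : List A) → total (λ _ → a) xs ≡ length xs * a
total-const a [] = refl
total-const a (x ∷ xs) = cong (a +_) (total-const a xs)

total-zero : {w : A → ℕ} → (∀ x → w x ≡ 0) → ∀ xs → total w xs ≡ 0
total-zero w≡0 [] = refl
total-zero w≡0 (x ∷ xs) = cong₂ _+_ (w≡0 x) (total-zero w≡0 xs)

total-concatMap : (w : A′ → ℕ) (f : A → List A′) (xs : List A) →
  total w (concatMap f xs) ≡ total (λ x → total w (f x)) xs
total-concatMap w f [] = refl
total-concatMap w f (x ∷ xs) = trans (total-++ w (f x) _) (cong (total w (f x) +_) (total-concatMap w f xs))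

total-map : (w : A′ → ℕ) (f : A → A′) (xs : List A) → total w (map f xs) ≡ total (w ∘ f) xs
total-map w f [] = refl
total-map w f (x ∷ xs) = cong (w (f x) +_) (total-map w f xs)

filterᵇ-accept : (p : A → Bool) (x : A) (xs : List A) → p x ≡ true → filterᵇ p (x ∷ xs) ≡ x ∷ filterᵇ p xs
filterᵇ-accept p x xs px rewrite px = refl

filterᵇ-reject : (p : A → Bool) (x : A) (xs : List A) → p x ≡ false → filterᵇ p (x ∷ xs) ≡ filterᵇ p xs
filterᵇ-reject p x xs px rewrite px = refl

filterᵇ-none : (p : A → Bool) {xs : List A} → All (λ x → p x ≡ false) xs → filterᵇ p xs ≡ []
filterᵇ-none p [] = refl
filterᵇ-none p {x ∷ xs} (px ∷ pxs) = trans (filterᵇ-reject p x xs px) (filterᵇ-none p pxs)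

filterᵇ-cong : {p q : A → Bool} {xs : List A} → All (λ x → p x ≡ q x) xs → filterᵇ p xs ≡ filterᵇ q xs
filterᵇ-cong [] = refl
filterᵇ-cong {p = p} {q} {x ∷ xs} (px≡qx ∷ eqs) rewrite px≡qx with q x
... | true = cong (x ∷_) (filterᵇ-cong eqs)
... | false = filterᵇ-cong eqs

filterᵇ-map : (p : A′ → Bool) (f : A → A′) (xs : List A) →
  filterᵇ p (map f xs) ≡ map f (filterᵇ (p ∘ f) xs)
filterᵇ-map p f [] = refl
filterᵇ-map p f (x ∷ xs) with p (f x)
... | true = cong (f x ∷_) (filterᵇ-map p f xs)
... | false = filterᵇ-map p f xs

map-filterᵇ-∷ : {f : A → A′} {p : A → Bool} {x : A} {xs : List A} {b : Bool} → p x ≡ b →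
  map f (filterᵇ p (x ∷ xs)) ≡ (if b then f x ∷ map f (filterᵇ p xs) else map f (filterᵇ p xs))
map-filterᵇ-∷ {b = true} px rewrite px = refl
map-filterᵇ-∷ {b = false} px rewrite px = refl

length-filter-≟ : (f : A → ℕ) (r : ℕ) (xs : List A) →
  length (filter (λ x → f x ≟ r) xs) ≡ total (λ x → δ (f x) r) xs
length-filter-≟ f r [] = refl
length-filter-≟ f r (x ∷ xs) with f x ≡ᵇ r
... | true = cong suc (length-filter-≟ f r xs)
... | false = length-filter-≟ f r xs

-- Left-to-right scans of a list τ that is preceded by a prefix whose minimum
-- is B.  A 132 can be completed inside τ, or use an entry of the prefix as
-- its "1"; in the latter case B may serve as that "1".

allAtMost : ℕ → List ℕ → Bool
allAtMost B [] = true
allAtMost B (z ∷ zs) = (z ≤ᵇ B) ∧ allAtMost B zs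

someBetween : ℕ → ℕ → List ℕ → Bool
someBetween B y [] = false
someBetween B y (z ∷ zs) = ((B <ᵇ z) ∧ (z <ᵇ y)) ∨ someBetween B y zs

-- no 132 occurs in the prefix followed by τ (given none occurs in the prefix)
avoidsAfter : ℕ → List ℕ → Bool
avoidsAfter B [] = true
avoidsAfter B (y ∷ ys) = avoidsAfter (B ⊓ y) ys ∧ not (someBetween B y ys)

exceedAfter : ℕ → List ℕ → ℕ
exceedAfter B [] = 0
exceedAfter B (y ∷ ys) = ⟦ B <ᵇ y ⟧ + exceedAfter (B ⊓ y) ys

-- number of gaps of τ (the end included) where a new maximum can be inserted
-- without creating a 132: those gaps followed only by entries ≤ the minimum
-- before the gap
sitesAfter : ℕ → List ℕ → ℕ
sitesAfter B [] = 1
sitesAfter B (y ∷ ys) = ⟦ allAtMost B (y ∷ ys) ⟧ + sitesAfter (B ⊓ y) ys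

Label : Set
Label = ℕ × ℕ

labelAfter : ℕ → List ℕ → Label
labelAfter B τ = (sitesAfter B τ , exceedAfter B τ)

-- The scans of a whole list: its first entry is the first running minimum.
-- The first component of the label omits the gap in front, which is
-- always available.
avoids : List ℕ → Bool
avoids [] = true
avoids (y ∷ ys) = avoidsAfter y ys

label : List ℕ → Label
label [] = (0 , 0)
label (y ∷ ys) = labelAfter y ys

Has32Above : ℕ → List ℕ → Set
Has32Above B τ = ∃[ j ] ∃[ k ] (j Fin.< k × B < at τ k × at τ k < at τ j)

Between : ℕ → ℕ → List ℕ → Set
Between B y τ = ∃[ k ] (B < at τ k × at τ k < y)

BadAfter : ℕ → List ℕ → Set
BadAfter B τ = Contains132 τ ⊎ Has32Above B τ

has32-lower : ∀ {B B′} τ → B′ ≤ B → Has32Above B τ → Has32Above B′ τ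
has32-lower τ B′≤B (j , k , j<k , B<τk , τk<τj) = (j , k , j<k , ≤-<-trans B′≤B B<τk , τk<τj)

has32-⊓ : ∀ B y τ → Has32Above (B ⊓ y) τ → Has32Above B τ ⊎ Has32Above y τ
has32-⊓ B y τ h with ≤-total B y
... | inj₁ B≤y rewrite m≤n⇒m⊓n≡m B≤y = inj₁ h
... | inj₂ y≤B rewrite m≥n⇒m⊓n≡n y≤B = inj₂ h

someBetween-true : ∀ B y τ → someBetween B y τ ≡ true ⇔ Between B y τ
someBetween-true B y τ = mk⇔ (to τ) (from τ)
  where
  to : ∀ τ → someBetween B y τ ≡ true → Between B y τ
  to (z ∷ zs) e with B <ᵇ z in B<z | z <ᵇ y in z<y
  ... | true | true = (zero , <ᵇ⇒< B z (subst T (sym B<z) _) , <ᵇ⇒< z y (subst T (sym z<y) _))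
  ... | true | false = let (k , between) = to zs e in (suc k , between)
  ... | false | _ = let (k , between) = to zs e in (suc k , between)
  from : ∀ τ → Between B y τ → someBetween B y τ ≡ true
  from (z ∷ zs) (zero , B<z , z<y) rewrite <ᵇ-true B<z | <ᵇ-true z<y = refl
  from (z ∷ zs) (suc k , between) rewrite from zs (k , between) = ∨-zeroʳ _

contains-cons : ∀ y ys → Contains132 (y ∷ ys) ⇔ BadAfter y ys
contains-cons y ys = mk⇔ to from
  where
  to : Contains132 (y ∷ ys) → BadAfter y ys
  to (zero , suc j , suc k , _ , s≤s j<k , a , b) = inj₂ (j , k , j<k , a , b)
  to (suc i , suc j , suc k , s≤s i<j , s≤s j<k , a , b) = inj₁ (i , j , k , i<j , j<k , a , b)
  from : BadAfter y ys → Contains132 (y ∷ ys)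
  from (inj₁ (i , j , k , i<j , j<k , a , b)) = (suc i , suc j , suc k , s≤s i<j , s≤s j<k , a , b)
  from (inj₂ (j , k , j<k , a , b)) = (zero , suc j , suc k , s≤s z≤n , s≤s j<k , a , b)

badAfter-cons : ∀ B y ys → BadAfter B (y ∷ ys) ⇔ (BadAfter (B ⊓ y) ys ⊎ Between B y ys)
badAfter-cons B y ys = mk⇔ to from
  where
  module C = Equivalence (contains-cons y ys)
  to : BadAfter B (y ∷ ys) → BadAfter (B ⊓ y) ys ⊎ Between B y ys
  to (inj₁ c) with C.to c
  ... | inj₁ c′ = inj₁ (inj₁ c′)
  ... | inj₂ h = inj₁ (inj₂ (has32-lower ys (m⊓n≤n B y) h))
  to (inj₂ (zero , suc k , _ , a , b)) = inj₂ (k , a , b)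
  to (inj₂ (suc j , suc k , s≤s j<k , a , b)) = inj₁ (inj₂ (has32-lower ys (m⊓n≤m B y) (j , k , j<k , a , b)))
  from : BadAfter (B ⊓ y) ys ⊎ Between B y ys → BadAfter B (y ∷ ys)
  from (inj₁ (inj₁ c)) = inj₁ (C.from (inj₁ c))
  from (inj₁ (inj₂ h)) with has32-⊓ B y ys h
  ... | inj₁ (j , k , j<k , a , b) = inj₂ (suc j , suc k , s≤s j<k , a , b)
  ... | inj₂ h′ = inj₁ (C.from (inj₂ h′))
  from (inj₂ (k , a , b)) = inj₂ (zero , suc k , s≤s z≤n , a , b)

avoidsAfter-false : ∀ B τ → avoidsAfter B τ ≡ false ⇔ BadAfter B τ
avoidsAfter-false B [] = mk⇔ (λ ()) λ { (inj₁ (() , _)) ; (inj₂ (() , _)) }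
avoidsAfter-false B (y ∷ ys) = mk⇔ to from
  where
  module IH = Equivalence (avoidsAfter-false (B ⊓ y) ys)
  module SB = Equivalence (someBetween-true B y ys)
  module BC = Equivalence (badAfter-cons B y ys)
  to : avoidsAfter B (y ∷ ys) ≡ false → BadAfter B (y ∷ ys)
  to e with avoidsAfter (B ⊓ y) ys in a | someBetween B y ys in s
  ... | false | _ = BC.from (inj₁ (IH.to a))
  ... | true | true = BC.from (inj₂ (SB.to s))
  to () | true | false
  from : BadAfter B (y ∷ ys) → avoidsAfter B (y ∷ ys) ≡ false
  from bad with BC.to bad
  ... | inj₁ b = cong (_∧ not (someBetween B y ys)) (IH.from b)
  ... | inj₂ between rewrite SB.from between = ∧-zeroʳ _

avoids-false : ∀ σ → avoids σ ≡ false ⇔ Contains132 σ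
avoids-false [] = mk⇔ (λ ()) λ { (() , _) }
avoids-false (y ∷ ys) = mk⇔
  (Equivalence.from (contains-cons y ys) ∘ Equivalence.to (avoidsAfter-false y ys))
  (Equivalence.from (avoidsAfter-false y ys) ∘ Equivalence.to (contains-cons y ys))

-- the form in which the filter defining S_n(132) can be replaced by the scan
avoids-decides : Avoids132 ≐ (T ∘ avoids)
avoids-decides = (λ {σ} → to {σ}) , (λ {σ} → from {σ})
  where
  to : ∀ {σ} → Avoids132 σ → T (avoids σ)
  to {σ} ¬c with avoids σ in e
  ... | true = _
  ... | false = ¬c (Equivalence.to (avoids-false σ) e)
  from : ∀ {σ} → T (avoids σ) → Avoids132 σ
  from {σ} t c = subst T (Equivalence.from (avoids-false σ) c) t

countTrue : ∀ {n} → (Fin n → Bool) → ℕ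
countTrue {zero} f = 0
countTrue {suc n} f = ⟦ f zero ⟧ + countTrue (f ∘ suc)

countTrue-cong : ∀ {n} {f g : Fin n → Bool} → (∀ i → f i ≡ g i) → countTrue f ≡ countTrue g
countTrue-cong {zero} e = refl
countTrue-cong {suc n} e = cong₂ _+_ (cong ⟦_⟧ (e zero)) (countTrue-cong (e ∘ suc))

length-filter-tabulate : ∀ {P : A → Set} (P? : ∀ x → Dec (P x)) {n} (g : Fin n → A) →
  length (filter P? (tabulate g)) ≡ countTrue (λ i → does (P? (g i)))
length-filter-tabulate P? {zero} g = refl
length-filter-tabulate P? {suc n} g with does (P? (g zero))
... | true = cong suc (length-filter-tabulate P? (g ∘ suc))
... | false = length-filter-tabulate P? (g ∘ suc)

does-reflects : ∀ {P : Set} (P? : Dec P) {b : Bool} → P ⇔ T b → does P? ≡ b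
does-reflects (yes p) {true} _ = refl
does-reflects (yes p) {false} P⇔b = ⊥-elim (Equivalence.to P⇔b p)
does-reflects (no ¬p) {true} P⇔b = ⊥-elim (¬p (Equivalence.from P⇔b _))
does-reflects (no ¬p) {false} _ = refl

T-does : ∀ {P : Set} (P? : Dec P) → T (does P?) ⇔ P
T-does (yes p) = mk⇔ (λ _ → p) (λ _ → _)
T-does (no ¬p) = mk⇔ (λ ()) ¬p

mmpPos-zero : ∀ y τ → does (mmpPos? (y ∷ τ) zero) ≡ false
mmpPos-zero y τ = does-reflects (mmpPos? (y ∷ τ) zero) (mk⇔ (λ { (j , () , _) }) λ ())

mmpPos-suc : ∀ y τ i → does (mmpPos? (y ∷ τ) (suc i)) ≡ (y <ᵇ at τ i) ∨ does (mmpPos? τ i)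
mmpPos-suc y τ i = does-reflects (mmpPos? (y ∷ τ) (suc i)) (mk⇔ to from)
  where
  to : MmpPos (y ∷ τ) (suc i) → T ((y <ᵇ at τ i) ∨ does (mmpPos? τ i))
  to (zero , _ , y<τi) = Equivalence.from T-∨ (inj₁ (<⇒<ᵇ y<τi))
  to (suc j , s≤s j<i , τj<τi) = Equivalence.from T-∨ (inj₂ (Equivalence.from (T-does (mmpPos? τ i)) (j , j<i , τj<τi)))
  from : T ((y <ᵇ at τ i) ∨ does (mmpPos? τ i)) → MmpPos (y ∷ τ) (suc i)
  from t with Equivalence.to T-∨ t
  ... | inj₁ y<τi = (zero , s≤s z≤n , <ᵇ⇒< y (at τ i) y<τi)
  ... | inj₂ w = let (j , j<i , τj<τi) = Equivalence.to (T-does (mmpPos? τ i)) w in (suc j , s≤s j<i , τj<τi)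

⊓-<ᵇ : ∀ B z x → ((B ⊓ z) <ᵇ x) ≡ (B <ᵇ x) ∨ (z <ᵇ x)
⊓-<ᵇ zero z zero = refl
⊓-<ᵇ zero z (suc x) = refl
⊓-<ᵇ (suc B) zero zero = refl
⊓-<ᵇ (suc B) zero (suc x) = sym (∨-zeroʳ _)
⊓-<ᵇ (suc B) (suc z) zero = refl
⊓-<ᵇ (suc B) (suc z) (suc x) = ⊓-<ᵇ B z x

exceedAfter-positions : ∀ B τ → countTrue (λ i → (B <ᵇ at τ i) ∨ does (mmpPos? τ i)) ≡ exceedAfter B τ
exceedAfter-positions B [] = refl
exceedAfter-positions B (z ∷ zs) = cong₂ _+_ (cong ⟦_⟧ first) (trans (countTrue-cong later) (exceedAfter-positions (B ⊓ z) zs))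
  where
  first : (B <ᵇ z) ∨ does (mmpPos? (z ∷ zs) zero) ≡ (B <ᵇ z)
  first rewrite mmpPos-zero z zs = ∨-identityʳ _
  later : ∀ i → (B <ᵇ at zs i) ∨ does (mmpPos? (z ∷ zs) (suc i)) ≡ ((B ⊓ z) <ᵇ at zs i) ∨ does (mmpPos? zs i)
  later i rewrite mmpPos-suc z zs i | ⊓-<ᵇ B z (at zs i) = sym (∨-assoc (B <ᵇ at zs i) _ _)

mmp-label : ∀ σ → mmp0010 σ ≡ proj₂ (label σ)
mmp-label [] = refl
mmp-label (y ∷ τ) =
  trans (length-filter-tabulate (mmpPos? (y ∷ τ)) (λ i → i))
    (cong₂ _+_ (cong ⟦_⟧ (mmpPos-zero y τ))
      (trans (countTrue-cong (mmpPos-suc y τ)) (exceedAfter-positions y τ)))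

-- Inserting a new maximum m.  The facts below only use that m exceeds every
-- entry of the list it is inserted into.

someBetween-max : ∀ {m} B σ → All (_< m) σ → someBetween B m σ ≡ not (allAtMost B σ)
someBetween-max B [] [] = refl
someBetween-max B (z ∷ zs) (z<m ∷ zs<m)
  rewrite <ᵇ-true z<m | ∧-identityʳ (B <ᵇ z) | someBetween-max B zs zs<m | <ᵇ-not-≤ᵇ B z
  with z ≤ᵇ B
... | true = refl
... | false = refl

someBetween-above-max : ∀ {m} y σ → All (_< m) σ → someBetween m y σ ≡ false
someBetween-above-max y [] [] = refl
someBetween-above-max {m} y (z ∷ zs) (z<m ∷ zs<m)
  rewrite <ᵇ-false {m} {z} (<⇒≤ z<m) = someBetween-above-max y zs zs<m

allAtMost-max : ∀ {m} σ → All (_< m) σ → allAtMost m σ ≡ true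
allAtMost-max [] [] = refl
allAtMost-max (z ∷ zs) (z<m ∷ zs<m) rewrite ≤ᵇ-true (<⇒≤ z<m) = allAtMost-max zs zs<m

insertions-allAtMost : ∀ {B m} ys → B < m → All (λ τ → allAtMost B τ ≡ false) (insertions m ys)
insertions-allAtMost [] B<m = cong (_∧ true) (≤ᵇ-false B<m) ∷ []
insertions-allAtMost {B} (z ∷ zs) B<m =
  cong (_∧ allAtMost B (z ∷ zs)) (≤ᵇ-false B<m) ∷
  All.map⁺ (All.map (λ {τ} e → trans (cong ((z ≤ᵇ B) ∧_) e) (∧-zeroʳ _)) (insertions-allAtMost zs B<m))

someBetween-front : ∀ {B y m} zs → y ≤ m → someBetween B y (m ∷ zs) ≡ someBetween B y zs
someBetween-front {B} {y} {m} zs y≤m rewrite <ᵇ-false {m} {y} y≤m | ∧-zeroʳ (B <ᵇ m) = refl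

insertions-someBetween : ∀ {B y m} ys → y ≤ m →
  All (λ τ → someBetween B y τ ≡ someBetween B y ys) (insertions m ys)
insertions-someBetween [] y≤m = someBetween-front [] y≤m ∷ []
insertions-someBetween {B} {y} (z ∷ zs) y≤m =
  someBetween-front (z ∷ zs) y≤m ∷
  All.map⁺ (All.map (cong (((B <ᵇ z) ∧ (z <ᵇ y)) ∨_)) (insertions-someBetween zs y≤m))

insertions-bounded : ∀ {m k} σ → m < k → All (_< k) σ → All (All (_< k)) (insertions m σ)
insertions-bounded [] m<k [] = (m<k ∷ []) ∷ []
insertions-bounded (y ∷ ys) m<k (y<k ∷ ys<k) =
  (m<k ∷ y<k ∷ ys<k) ∷ All.map⁺ (All.map (y<k ∷_) (insertions-bounded ys m<k ys<k))

perms-bounded : ∀ n → All (All (_< suc n)) (perms n)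
perms-bounded zero = [] ∷ []
perms-bounded (suc n) =
  All.concat⁺ (All.map⁺ (All.map (λ {σ} σ≤n → insertions-bounded σ ≤-refl (All.map m<n⇒m<1+n σ≤n)) (perms-bounded n)))

front-avoidsAfter : ∀ {B m} τ → B < m → All (_< m) τ → avoidsAfter B τ ≡ true →
  avoidsAfter B (m ∷ τ) ≡ allAtMost B τ
front-avoidsAfter {B} τ B<m τ<m av
  rewrite m≤n⇒m⊓n≡m (<⇒≤ B<m) | av | someBetween-max B τ τ<m = not-involutive _

front-labelAfter : ∀ {B m} τ → B < m → labelAfter B (m ∷ τ) ≡ (sitesAfter B τ , suc (exceedAfter B τ))
front-labelAfter τ B<m rewrite m≤n⇒m⊓n≡m (<⇒≤ B<m) | ≤ᵇ-false B<m | <ᵇ-true B<m = refl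

-- Insertions of m behind y, given the labels of the insertions into ys:
-- y only lowers the running minimum (which stays below m) and adds
-- ⟦ B <ᵇ y ⟧ to the count.
later-insertions : ∀ {B m c K} y ys → B < m → y < m → someBetween B y ys ≡ false →
  map (labelAfter (B ⊓ y)) (filterᵇ (avoidsAfter (B ⊓ y)) (insertions m ys))
    ≡ map (λ j → (suc j , suc c)) (downFrom K) →
  map (labelAfter B) (filterᵇ (avoidsAfter B) (map (y ∷_) (insertions m ys)))
    ≡ map (λ j → (suc j , suc (⟦ B <ᵇ y ⟧ + c))) (downFrom K)
later-insertions {B} {m} {c} {K} y ys B<m y<m noBetween ih = begin
    map (labelAfter B) (filterᵇ (avoidsAfter B) (map (y ∷_) X))
  ≡⟨ cong (map (labelAfter B)) (filterᵇ-map (avoidsAfter B) (y ∷_) X) ⟩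
    map (labelAfter B) (map (y ∷_) (filterᵇ (avoidsAfter B ∘ (y ∷_)) X))
  ≡⟨ cong (map (labelAfter B) ∘ map (y ∷_)) (filterᵇ-cong (All.map (λ {τ} → same-avoidance {τ}) (insertions-someBetween ys (<⇒≤ y<m)))) ⟩
    map (labelAfter B) (map (y ∷_) Z)
  ≡⟨ sym (map-∘ Z) ⟩
    map (labelAfter B ∘ (y ∷_)) Z
  ≡⟨ map-cong-local (All.filter⁺ (T? ∘ avoidsAfter (B ⊓ y)) (All.map (λ {τ} → shifted-label {τ}) (insertions-allAtMost ys B<m))) ⟩
    map (shift ∘ labelAfter (B ⊓ y)) Z
  ≡⟨ map-∘ Z ⟩
    map shift (map (labelAfter (B ⊓ y)) Z)
  ≡⟨ cong (map shift) ih ⟩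
    map shift (map (λ j → (suc j , suc c)) (downFrom K))
  ≡⟨ sym (map-∘ (downFrom K)) ⟩
    map (λ j → (suc j , ⟦ B <ᵇ y ⟧ + suc c)) (downFrom K)
  ≡⟨ map-cong (λ j → cong (suc j ,_) (+-suc ⟦ B <ᵇ y ⟧ c)) (downFrom K) ⟩
    map (λ j → (suc j , suc (⟦ B <ᵇ y ⟧ + c))) (downFrom K)
  ∎
  where
  open ≡-Reasoning
  X = insertions m ys
  Z = filterᵇ (avoidsAfter (B ⊓ y)) X
  shift : Label → Label
  shift (k , e) = (k , ⟦ B <ᵇ y ⟧ + e)
  same-avoidance : ∀ {τ} → someBetween B y τ ≡ someBetween B y ys → avoidsAfter B (y ∷ τ) ≡ avoidsAfter (B ⊓ y) τ
  same-avoidance {τ} e rewrite e | noBetween = ∧-identityʳ _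
  shifted-label : ∀ {τ} → allAtMost B τ ≡ false → labelAfter B (y ∷ τ) ≡ shift (labelAfter (B ⊓ y) τ)
  shifted-label e rewrite e | ∧-zeroʳ (y ≤ᵇ B) = refl

insertMaxAfter-labels : ∀ {B m} τ → B < m → All (_< m) τ → avoidsAfter B τ ≡ true →
  map (labelAfter B) (filterᵇ (avoidsAfter B) (insertions m τ))
    ≡ map (λ j → (suc j , suc (exceedAfter B τ))) (downFrom (sitesAfter B τ))
insertMaxAfter-labels [] B<m [] _ rewrite ≤ᵇ-false B<m | <ᵇ-true B<m = refl
insertMaxAfter-labels {B} {m} (y ∷ ys) B<m (y<m ∷ ys<m) av = begin
    map (labelAfter B) (filterᵇ (avoidsAfter B) ((m ∷ σ) ∷ rest))
  ≡⟨ map-filterᵇ-∷ {f = labelAfter B} {p = avoidsAfter B} {x = m ∷ σ} {xs = rest} (front-avoidsAfter σ B<m (y<m ∷ ys<m) av) ⟩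
    (if allAtMost B σ then labelAfter B (m ∷ σ) ∷ map (labelAfter B) (filterᵇ (avoidsAfter B) rest)
     else map (labelAfter B) (filterᵇ (avoidsAfter B) rest))
  ≡⟨ cong₂ (λ h t → if allAtMost B σ then h ∷ t else t) (front-labelAfter σ B<m) later ⟩
    (if allAtMost B σ then (sitesAfter B σ , suc c) ∷ map g (downFrom K′) else map g (downFrom K′))
  ≡⟨ prepend-site (allAtMost B σ) ⟩
    map g (downFrom (sitesAfter B σ))
  ∎
  where
  open ≡-Reasoning
  σ = y ∷ ys
  rest = map (y ∷_) (insertions m ys)
  c = exceedAfter B σ
  K′ = sitesAfter (B ⊓ y) ys
  g : ℕ → Label
  g j = (suc j , suc c)
  ys-avoids = ∧-not-true av
  later = later-insertions y ys B<m y<m (proj₂ ys-avoids)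
    (insertMaxAfter-labels ys (m<n⇒m⊓o<n y B<m) ys<m (proj₁ ys-avoids))
  prepend-site : ∀ b → (if b then (⟦ b ⟧ + K′ , suc c) ∷ map g (downFrom K′) else map g (downFrom K′))
    ≡ map g (downFrom (⟦ b ⟧ + K′))
  prepend-site true = refl
  prepend-site false = refl

insertMaxAfter-bad : ∀ {B m} τ → B < m → All (_< m) τ → avoidsAfter B τ ≡ false →
  All (λ τ′ → avoidsAfter B τ′ ≡ false) (insertions m τ)
insertMaxAfter-bad [] _ _ ()
insertMaxAfter-bad {B} {m} (y ∷ ys) B<m (y<m ∷ ys<m) bad =
  cong (_∧ not (someBetween B m (y ∷ ys))) (trans (cong (λ b → avoidsAfter b (y ∷ ys)) (m≤n⇒m⊓n≡m (<⇒≤ B<m))) bad)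
  ∷ All.map⁺ later
  where
  later : All (λ τ′ → avoidsAfter (B ⊓ y) τ′ ∧ not (someBetween B y τ′) ≡ false) (insertions m ys)
  later with ∧-not-false bad
  ... | inj₁ ys-bad =
    All.map (λ {τ′} e → cong (_∧ not (someBetween B y τ′)) e) (insertMaxAfter-bad ys (m<n⇒m⊓o<n y B<m) ys<m ys-bad)
  ... | inj₂ between =
    All.map (λ {τ′} e → trans (cong (λ s → avoidsAfter (B ⊓ y) τ′ ∧ not s) (trans e between)) (∧-zeroʳ _))
      (insertions-someBetween ys (<⇒≤ y<m))

front-avoids : ∀ {m} σ → All (_< m) σ → avoids (m ∷ σ) ≡ avoids σ
front-avoids [] [] = refl
front-avoids {m} (y ∷ ys) (y<m ∷ ys<m)
  rewrite m≥n⇒m⊓n≡n (<⇒≤ y<m) | someBetween-above-max y ys ys<m = ∧-identityʳ _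

front-label : ∀ {m} y ys → All (_< m) (y ∷ ys) → label (m ∷ y ∷ ys) ≡ (suc (sitesAfter y ys) , exceedAfter y ys)
front-label {m} y ys (y<m ∷ ys<m)
  rewrite allAtMost-max (y ∷ ys) (y<m ∷ ys<m) | m≥n⇒m⊓n≡n (<⇒≤ y<m) | <ᵇ-false {m} {y} (<⇒≤ y<m) = refl

children : Label → List Label
children (k , c) = (suc k , c) ∷ map (λ j → (suc j , suc c)) (downFrom k)

insertMax-labels : ∀ {m} σ → All (_< m) σ → avoids σ ≡ true →
  map label (filterᵇ avoids (insertions m σ)) ≡ children (label σ)
insertMax-labels [] [] _ = refl
insertMax-labels {m} (y ∷ ys) (y<m ∷ ys<m) av = begin
    map label (filterᵇ avoids ((m ∷ y ∷ ys) ∷ map (y ∷_) X))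
  ≡⟨ cong (map label) (filterᵇ-accept avoids (m ∷ y ∷ ys) (map (y ∷_) X) (trans (front-avoids (y ∷ ys) (y<m ∷ ys<m)) av)) ⟩
    label (m ∷ y ∷ ys) ∷ map label (filterᵇ avoids (map (y ∷_) X))
  ≡⟨ cong₂ _∷_ (front-label y ys (y<m ∷ ys<m)) (cong (map label) (filterᵇ-map avoids (y ∷_) X)) ⟩
    (suc (sitesAfter y ys) , exceedAfter y ys) ∷ map label (map (y ∷_) (filterᵇ (avoidsAfter y) X))
  ≡⟨ cong ((suc (sitesAfter y ys) , exceedAfter y ys) ∷_)
       (trans (sym (map-∘ (filterᵇ (avoidsAfter y) X))) (insertMaxAfter-labels ys y<m ys<m av)) ⟩
    children (label (y ∷ ys))
  ∎
  where
  open ≡-Reasoning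
  X = insertions m ys

insertMax-bad : ∀ {m} σ → All (_< m) σ → avoids σ ≡ false → All (λ σ′ → avoids σ′ ≡ false) (insertions m σ)
insertMax-bad [] [] ()
insertMax-bad (y ∷ ys) (y<m ∷ ys<m) bad =
  trans (front-avoids (y ∷ ys) (y<m ∷ ys<m)) bad ∷ All.map⁺ (insertMaxAfter-bad ys y<m ys<m bad)

surviving-labels : ∀ {m} P → All (All (_< m)) P →
  map label (filterᵇ avoids (concatMap (insertions m) P)) ≡ concatMap children (map label (filterᵇ avoids P))
surviving-labels [] [] = refl
surviving-labels {m} (σ ∷ P) (σ<m ∷ P<m) = begin
    map label (filterᵇ avoids (insertions m σ ++ concatMap (insertions m) P))
  ≡⟨ cong (map label) (filter-++ (T? ∘ avoids) (insertions m σ) _) ⟩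
    map label (filterᵇ avoids (insertions m σ) ++ filterᵇ avoids (concatMap (insertions m) P))
  ≡⟨ map-++ label (filterᵇ avoids (insertions m σ)) _ ⟩
    map label (filterᵇ avoids (insertions m σ)) ++ map label (filterᵇ avoids (concatMap (insertions m) P))
  ≡⟨ cong (map label (filterᵇ avoids (insertions m σ)) ++_) (surviving-labels P P<m) ⟩
    map label (filterᵇ avoids (insertions m σ)) ++ rest
  ≡⟨ head-contribution (avoids σ) refl ⟩
    concatMap children (map label (filterᵇ avoids (σ ∷ P)))
  ∎
  where
  open ≡-Reasoning
  rest = concatMap children (map label (filterᵇ avoids P))
  head-contribution : ∀ b → avoids σ ≡ b →
    map label (filterᵇ avoids (insertions m σ)) ++ rest ≡ concatMap children (map label (filterᵇ avoids (σ ∷ P)))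
  head-contribution true e =
    trans (cong (_++ rest) (insertMax-labels σ σ<m e))
          (sym (cong (concatMap children ∘ map label) (filterᵇ-accept avoids σ P e)))
  head-contribution false e =
    trans (cong (λ l → map label l ++ rest) (filterᵇ-none avoids (insertMax-bad σ σ<m e)))
          (sym (cong (concatMap children ∘ map label) (filterᵇ-reject avoids σ P e)))

level : ℕ → List Label
level zero = (0 , 0) ∷ []
level (suc n) = concatMap children (level n)

labels-of-avoiders : ∀ n → map label (filterᵇ avoids (perms n)) ≡ level n
labels-of-avoiders zero = refl
labels-of-avoiders (suc n) =
  trans (surviving-labels (perms n) (perms-bounded n)) (cong (concatMap children) (labels-of-avoiders n))

count : ℕ → List Label → ℕ
count r = total (λ x → δ (proj₂ x) r)

coeffQ-count : ∀ n r → coeffQ n r ≡ count r (level n)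
coeffQ-count n r = begin
    length (filter (λ σ → mmp0010 σ ≟ r) (filter avoids132? (perms n)))
  ≡⟨ cong (λ l → length (filter (λ σ → mmp0010 σ ≟ r) l)) (filter-≐ avoids132? (T? ∘ avoids) avoids-decides (perms n)) ⟩
    length (filter (λ σ → mmp0010 σ ≟ r) avoiders)
  ≡⟨ length-filter-≟ mmp0010 r avoiders ⟩
    total (λ σ → δ (mmp0010 σ) r) avoiders
  ≡⟨ total-cong (universal (λ σ → cong (λ c → δ c r) (mmp-label σ)) avoiders) ⟩
    total (λ σ → δ (proj₂ (label σ)) r) avoiders
  ≡⟨ sym (total-map (λ x → δ (proj₂ x) r) label avoiders) ⟩
    count r (map label avoiders)
  ≡⟨ cong (count r) (labels-of-avoiders n) ⟩
    count r (level n)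
  ∎
  where
  open ≡-Reasoning
  avoiders = filterᵇ avoids (perms n)

-- what a label contributes to count r on the next level: its first child
-- keeps c, its other k children have c+1
offspring : ℕ → Label → ℕ
offspring r (k , c) = δ c r + k * δ (suc c) r

count-children : ∀ r x → count r (children x) ≡ offspring r x
count-children r (k , c) = cong (δ c r +_) (begin
    count r (map (λ j → (suc j , suc c)) (downFrom k))
  ≡⟨ total-map (λ x → δ (proj₂ x) r) (λ j → (suc j , suc c)) (downFrom k) ⟩
    total (λ _ → δ (suc c) r) (downFrom k)
  ≡⟨ total-const (δ (suc c) r) (downFrom k) ⟩
    length (downFrom k) * δ (suc c) r
  ≡⟨ cong (_* δ (suc c) r) (length-downFrom k) ⟩
    k * δ (suc c) r
  ∎)
  where open ≡-Reasoning

count-next : ∀ r n → count r (level (suc n)) ≡ total (offspring r) (level n)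
count-next r n =
  trans (total-concatMap (λ x → δ (proj₂ x) r) children (level n))
        (total-cong (universal (count-children r) (level n)))

-- Invariant of level n: a label (k , c) has k + c ≤ n, and c = 0 only for
-- the decreasing permutation, labelled (n , 0).  Below the root also k ≥ 1.
Valid : ℕ → Label → Set
Valid n (k , c) = k + c ≤ n × (c ≡ 0 → k ≡ n)

downFrom-< : ∀ k → All (_< k) (downFrom k)
downFrom-< k = All.applyDownFrom⁺₁ (λ j → j) k (λ j<k → j<k)

children-valid : ∀ n x → Valid n x → All (Valid (suc n)) (children x)
children-valid n (k , c) (k+c≤n , c≡0⇒k≡n) =
  (s≤s k+c≤n , cong suc ∘ c≡0⇒k≡n) ∷ All.map⁺ (All.map later (downFrom-< k))
  where
  later : ∀ {j} → j < k → Valid (suc n) (suc j , suc c)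
  later {j} j<k = s≤s (≤-trans (≤-reflexive (+-suc j c)) (≤-trans (+-monoˡ-≤ c j<k) k+c≤n)) , λ ()

level-valid : ∀ n → All (Valid n) (level n)
level-valid zero = (z≤n , λ _ → refl) ∷ []
level-valid (suc n) = All.concat⁺ (All.map⁺ (All.map (λ {x} → children-valid n x) (level-valid n)))

level-valid⁺ : ∀ n → All (λ x → Valid (suc n) x × 1 ≤ proj₁ x) (level (suc n))
level-valid⁺ n = All.zip (level-valid (suc n) , All.concat⁺ (All.map⁺ (universal positive (level n))))
  where
  positive : ∀ x → All (λ y → 1 ≤ proj₁ y) (children x)
  positive (k , c) = s≤s z≤n ∷ All.map⁺ (universal (λ _ → s≤s z≤n) (downFrom k))

count-zero : ∀ n → count 0 (level n) ≡ 1
count-zero zero = refl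
count-zero (suc n) =
  trans (count-next 0 n) (trans (total-cong (universal keeps-zero (level n))) (count-zero n))
  where
  keeps-zero : ∀ x → offspring 0 x ≡ δ (proj₂ x) 0
  keeps-zero (k , c) = trans (cong (δ c 0 +_) (*-zeroʳ k)) (+-identityʳ _)

pascal₂ : ∀ n → n C 2 + n ≡ suc n C 2
pascal₂ n = trans (+-comm (n C 2) n) (trans (cong (_+ n C 2) (sym (nC1≡n n))) (nCk+nC[k+1]≡[n+1]C[k+1] n 1))

count-one : ∀ n → count 1 (level n) ≡ n C 2
count-one zero = refl
count-one (suc n) = begin
    count 1 (level (suc n))
  ≡⟨ count-next 1 n ⟩
    total (offspring 1) (level n)
  ≡⟨ total-cong (All.map (λ {x} → offspring-one x) (level-valid n)) ⟩
    total (λ x → δ (proj₂ x) 1 + n * δ (proj₂ x) 0) (level n)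
  ≡⟨ total-+ (λ x → δ (proj₂ x) 1) (λ x → n * δ (proj₂ x) 0) (level n) ⟩
    count 1 (level n) + total (λ x → n * δ (proj₂ x) 0) (level n)
  ≡⟨ cong₂ _+_ (count-one n) (trans (total-scale n (λ x → δ (proj₂ x) 0) (level n)) (cong (n *_) (count-zero n))) ⟩
    n C 2 + n * 1
  ≡⟨ trans (cong (n C 2 +_) (*-identityʳ n)) (pascal₂ n) ⟩
    suc n C 2
  ∎
  where
  open ≡-Reasoning
  -- the unique label with c = 0 has k = n
  offspring-one : ∀ x → Valid n x → offspring 1 x ≡ δ (proj₂ x) 1 + n * δ (proj₂ x) 0
  offspring-one (k , zero) (_ , c≡0⇒k≡n) rewrite c≡0⇒k≡n refl = refl
  offspring-one (k , suc c) _ = cong (δ (suc c) 1 +_) (trans (*-zeroʳ k) (sym (*-zeroʳ n)))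

-- A valid label (k , c) with k ≥ 1 leaves room for c only up to the level
-- minus k: once c is within two of the level, k is 1 or 2.
sites-one : ∀ {k} c → k + c ≤ 1 + c → 1 ≤ k → k ≡ 1
sites-one {k} c le 1≤k = ≤-antisym (+-cancelʳ-≤ c k 1 le) 1≤k

sites-two : ∀ {k} c → k + c ≤ 2 + c → 1 ≤ k → k ≡ 1 ⊎ k ≡ 2
sites-two {suc zero} c _ _ = inj₁ refl
sites-two {suc (suc zero)} c _ _ = inj₂ refl
sites-two {suc (suc (suc k))} c le _ with +-cancelʳ-≤ c (3 + k) 2 le
... | s≤s (s≤s ())

no-room : ∀ {k} c → k + c ≤ c → ¬ (1 ≤ k)
no-room {k} c le 1≤k with ≤-trans 1≤k (+-cancelʳ-≤ c k 0 le)
... | ()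

count-top : ∀ n → count n (level (suc n)) ≡ 1
count-top zero = refl
count-top (suc n) =
  trans (count-next (suc n) (suc n))
    (trans (total-cong (All.map (λ {x} → offspring-top x) (level-valid⁺ n))) (count-top n))
  where
  offspring-top : ∀ x → Valid (suc n) x × 1 ≤ proj₁ x → offspring (suc n) x ≡ δ (proj₂ x) n
  offspring-top (k , c) ((k+c≤ , _) , 1≤k) with c ≟ n
  ... | yes refl with sites-one n k+c≤ 1≤k
  ...   | refl rewrite δ-suc n = +-identityʳ _
  offspring-top (k , c) ((k+c≤ , _) , 1≤k) | no c≢n
    rewrite δ-≢ c≢n | δ-≢ {c} {suc n} (λ { refl → no-room (suc n) k+c≤ 1≤k }) = *-zeroʳ k

corner-weight : ℕ → Label → ℕ
corner-weight t (k , c) = δ c t * δ k 2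

corner : ∀ t → total (corner-weight t) (level (2 + t)) ≡ suc t
corner zero = refl
corner (suc t) = begin
    total (corner-weight (suc t)) (level (3 + t))
  ≡⟨ total-concatMap (corner-weight (suc t)) children L ⟩
    total (λ x → total (corner-weight (suc t)) (children x)) L
  ≡⟨ total-cong (All.map (λ {x} → corner-children x) (level-valid⁺ (suc t))) ⟩
    total (λ x → δ (proj₂ x) (suc t) + corner-weight t x) L
  ≡⟨ total-+ (λ x → δ (proj₂ x) (suc t)) (corner-weight t) L ⟩
    count (suc t) L + total (corner-weight t) L
  ≡⟨ cong₂ _+_ (count-top (suc t)) (corner t) ⟩
    suc (suc t)
  ∎
  where
  open ≡-Reasoning
  L = level (2 + t)
  -- (1 , t+1) has the child (2 , t+1); (2 , t) has the child (2 , t+1)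
  corner-children : ∀ x → Valid (2 + t) x × 1 ≤ proj₁ x →
    total (corner-weight (suc t)) (children x) ≡ δ (proj₂ x) (suc t) + corner-weight t x
  corner-children (k , c) ((k+c≤ , _) , 1≤k) with c ≟ suc t | c ≟ t
  ... | yes refl | _ with sites-one (suc t) k+c≤ 1≤k
  ...   | refl rewrite δ-diag t = cong suc (+-identityʳ _)
  corner-children (k , c) ((k+c≤ , _) , 1≤k) | no _ | yes refl with sites-two t k+c≤ 1≤k
  ... | inj₁ refl rewrite δ-suc t | δ-diag t = refl
  ... | inj₂ refl rewrite δ-suc t | δ-diag t = refl
  corner-children (k , c) _ | no c≢t+1 | no c≢t = begin
      δ c (suc t) * δ (suc k) 2 + total (corner-weight (suc t)) (map (λ j → (suc j , suc c)) (downFrom k))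
    ≡⟨ cong₂ _+_ (cong (_* δ (suc k) 2) (δ-≢ c≢t+1))
         (trans (total-map (corner-weight (suc t)) _ (downFrom k))
                (total-zero (λ j → cong (_* δ j 1) (δ-≢ c≢t)) (downFrom k))) ⟩
      0
    ≡⟨ sym (cong₂ _+_ (δ-≢ c≢t+1) (cong (_* δ k 2) (δ-≢ c≢t))) ⟩
      δ c (suc t) + δ c t * δ k 2
    ∎

count-second : ∀ t → count t (level (2 + t)) ≡ (2 + t) C 2
count-second zero = refl
count-second (suc t) = begin
    count (suc t) (level (3 + t))
  ≡⟨ count-next (suc t) (2 + t) ⟩
    total (offspring (suc t)) L
  ≡⟨ total-cong (All.map (λ {x} → offspring-second x) (level-valid⁺ (suc t))) ⟩
    total (λ x → δ (proj₂ x) (suc t) + (δ (proj₂ x) t + corner-weight t x)) L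
  ≡⟨ total-+ (λ x → δ (proj₂ x) (suc t)) _ L ⟩
    count (suc t) L + total (λ x → δ (proj₂ x) t + corner-weight t x) L
  ≡⟨ cong (count (suc t) L +_) (total-+ (λ x → δ (proj₂ x) t) (corner-weight t) L) ⟩
    count (suc t) L + (count t L + total (corner-weight t) L)
  ≡⟨ cong₂ _+_ (count-top (suc t)) (cong₂ _+_ (count-second t) (corner t)) ⟩
    suc ((2 + t) C 2 + suc t)
  ≡⟨ sym (+-suc ((2 + t) C 2) (suc t)) ⟩
    (2 + t) C 2 + (2 + t)
  ≡⟨ pascal₂ (2 + t) ⟩
    (3 + t) C 2
  ∎
  where
  open ≡-Reasoning
  L = level (2 + t)
  -- a label (k , t) has k ∈ {1, 2}, and k = 2 exactly for the corner labels
  offspring-second : ∀ x → Valid (2 + t) x × 1 ≤ proj₁ x →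
    offspring (suc t) x ≡ δ (proj₂ x) (suc t) + (δ (proj₂ x) t + corner-weight t x)
  offspring-second (k , c) ((k+c≤ , _) , 1≤k) = cong (δ c (suc t) +_) (sites-times-δ (c ≟ t))
    where
    sites-times-δ : Dec (c ≡ t) → k * δ c t ≡ δ c t + δ c t * δ k 2
    sites-times-δ (yes refl) rewrite δ-diag c with sites-two c k+c≤ 1≤k
    ... | inj₁ refl = refl
    ... | inj₂ refl = refl
    sites-times-δ (no c≢t) rewrite δ-≢ c≢t = *-zeroʳ k

theorem16 : ((n : ℕ) → 1 ≤ n → coeffQ n 0 ≡ 1)
    × ((n : ℕ) → 2 ≤ n → coeffQ n (n ∸ 1) ≡ 1)
    × ((n : ℕ) → 2 ≤ n → coeffQ n 1 ≡ n C 2)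
    × ((n : ℕ) → 3 ≤ n → coeffQ n (n ∸ 2) ≡ n C 2)
theorem16 = constant-term , top-coefficient , linear-coefficient , second-coefficient
  where
  constant-term : (n : ℕ) → 1 ≤ n → coeffQ n 0 ≡ 1
  constant-term n _ = trans (coeffQ-count n 0) (count-zero n)

  top-coefficient : (n : ℕ) → 2 ≤ n → coeffQ n (n ∸ 1) ≡ 1
  top-coefficient (suc n) _ = trans (coeffQ-count (suc n) n) (count-top n)
  top-coefficient zero ()

  linear-coefficient : (n : ℕ) → 2 ≤ n → coeffQ n 1 ≡ n C 2
  linear-coefficient n _ = trans (coeffQ-count n 1) (count-one n)

  second-coefficient : (n : ℕ) → 3 ≤ n → coeffQ n (n ∸ 2) ≡ n C 2
  second-coefficient (suc (suc t)) _ = trans (coeffQ-count (2 + t) t) (count-second t)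
  second-coefficient (suc zero) (s≤s ())
  second-coefficient zero ()
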